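{- Let $T$ be a Frobenius monad on a dagger category $\mathcal{C}$. Then the Kleisli category $\mathcal{C}_T$ carries a dagger, namely sending $f\colon A\to T(B)$ to $T(f^\dagger)\circ\mu_B^\dagger\circ\eta_B\colon B\to T(A)$, that commutes with the canonical functors $\mathcal{C}_T\to\mathcal{C}$ and $\mathcal{C}\to\mathcal{C}_T$.
   Context: A dagger category has an identity-on-objects contravariant functor $f\mapsto f^\dagger$ with $f^{\dagger\dagger}=f$. A Frobenius monad on $\mathcal{C}$ is a monad $(T,\mu,\eta)$ with $T(f^\dagger)=T(f)^\dagger$ for all $f$ and $T(\mu_A)\circ\mu^\dagger_{T(A)}=\mu_{T(A)}\circ T(\mu_A^\dagger)$ for all $A$. The Kleisli category $\mathcal{C}_T$ has the objects of $\mathcal{C}$, morphisms $A\to B$ the morphisms $A\to T(B)$ of $\mathcal{C}$, identities $\eta$, and composition $g\circ_T f=\mu\circ T(g)\circ f$. The canonical functor $\mathcal{C}_T\to\mathcal{C}$ maps $A\mapsto T(A)$ and $f\mapsto\mu\circ T(f)$; the canonical functor $\mathcal{C}\to\mathcal{C}_T$ maps $A\mapsto A$ and $f\mapsto\eta\circ f$. A functor commutes with daggers if it preserves them. -}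

module Defs where

open import Level using (Level; _⊔_; suc)
open import Relation.Binary using (IsEquivalence)

record Category (o ℓ e : Level) : Set (suc (o ⊔ ℓ ⊔ e)) where
  infix  4 _≈_
  infixr 9 _∘_
  field
    Obj  : Set o
    _⇒_  : Obj → Obj → Set ℓ
    _≈_  : ∀ {A B} → A ⇒ B → A ⇒ B → Set e
    id   : ∀ {A} → A ⇒ A
    _∘_  : ∀ {A B C} → B ⇒ C → A ⇒ B → A ⇒ C
    equiv     : ∀ {A B} → IsEquivalence (_≈_ {A} {B})
    ∘-resp-≈  : ∀ {A B C} {f h : B ⇒ C} {g i : A ⇒ B} → f ≈ h → g ≈ i → f ∘ g ≈ h ∘ i
    assoc     : ∀ {A B C D} {f : A ⇒ B} {g : B ⇒ C} {h : C ⇒ D} → (h ∘ g) ∘ f ≈ h ∘ (g ∘ f)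
    identityˡ : ∀ {A B} {f : A ⇒ B} → id ∘ f ≈ f
    identityʳ : ∀ {A B} {f : A ⇒ B} → f ∘ id ≈ f

record IsDagger {o ℓ e} (C : Category o ℓ e)
                (_† : ∀ {A B} → Category._⇒_ C A B → Category._⇒_ C B A)
                : Set (o ⊔ ℓ ⊔ e) where
  open Category C
  field
    †-resp-≈  : ∀ {A B} {f g : A ⇒ B} → f ≈ g → (f †) ≈ (g †)
    †-identity : ∀ {A} → (id {A} †) ≈ id
    †-homomorphism : ∀ {A B C} {f : A ⇒ B} {g : B ⇒ C} → ((g ∘ f) †) ≈ (f †) ∘ (g †)
    †-involutive : ∀ {A B} {f : A ⇒ B} → ((f †) †) ≈ f

record DaggerCategory (o ℓ e : Level) : Set (suc (o ⊔ ℓ ⊔ e)) where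
  field
    category : Category o ℓ e
  open Category category
  field
    _† : ∀ {A B} → A ⇒ B → B ⇒ A
    isDagger : IsDagger category _†
  open Category category public

record Functor {o ℓ e o′ ℓ′ e′} (C : Category o ℓ e) (D : Category o′ ℓ′ e′)
               : Set (o ⊔ ℓ ⊔ e ⊔ o′ ⊔ ℓ′ ⊔ e′) where
  private
    module C = Category C
    module D = Category D
  field
    F₀ : C.Obj → D.Obj
    F₁ : ∀ {A B} → A C.⇒ B → F₀ A D.⇒ F₀ B
    identity     : ∀ {A} → F₁ (C.id {A}) D.≈ D.id
    homomorphism : ∀ {A B C} {f : A C.⇒ B} {g : B C.⇒ C} → F₁ (g C.∘ f) D.≈ F₁ g D.∘ F₁ f
    F-resp-≈     : ∀ {A B} {f g : A C.⇒ B} → f C.≈ g → F₁ f D.≈ F₁ g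

record Monad {o ℓ e} (C : Category o ℓ e) : Set (o ⊔ ℓ ⊔ e) where
  open Category C
  field
    F : Functor C C
  open Functor F public renaming (F₀ to T₀; F₁ to T₁)
  field
    η : ∀ A → A ⇒ T₀ A
    μ : ∀ A → T₀ (T₀ A) ⇒ T₀ A
    η-natural : ∀ {A B} (f : A ⇒ B) → η B ∘ f ≈ T₁ f ∘ η A
    μ-natural : ∀ {A B} (f : A ⇒ B) → μ B ∘ T₁ (T₁ f) ≈ T₁ f ∘ μ A
    assoc     : ∀ {A} → μ A ∘ T₁ (μ A) ≈ μ A ∘ μ (T₀ A)
    identityˡ : ∀ {A} → μ A ∘ T₁ (η A) ≈ id
    identityʳ : ∀ {A} → μ A ∘ η (T₀ A) ≈ id

record IsFrobenius {o ℓ e} (𝒞 : DaggerCategory o ℓ e)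
                   (M : Monad (DaggerCategory.category 𝒞)) : Set (o ⊔ ℓ ⊔ e) where
  open DaggerCategory 𝒞
  open Monad M
  field
    T-† : ∀ {A B} (f : A ⇒ B) → T₁ (f †) ≈ (T₁ f) †
    frobenius : ∀ A → T₁ (μ A) ∘ (μ (T₀ A)) † ≈ μ (T₀ A) ∘ T₁ ((μ A) †)

module _ {o ℓ e} {C : Category o ℓ e} (M : Monad C) where
  open Category C
  open Monad M

  Kleisli : Category o ℓ e
  Kleisli = record
    { Obj = Obj
    ; _⇒_ = λ A B → A ⇒ T₀ B
    ; _≈_ = _≈_
    ; id = λ {A} → η A
    ; _∘_ = λ {A} {B} {C} g f → μ C ∘ T₁ g ∘ f
    ; equiv = equiv
    ; ∘-resp-≈ = λ p q → ∘-resp-≈ Equiv.refl (∘-resp-≈ (F-resp-≈ p) q)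
    ; assoc = kassoc
    ; identityˡ = kidl
    ; identityʳ = kidr
    }
    where
      module Equiv {A B} = IsEquivalence (equiv {A} {B})
      refl′ : ∀ {A B} {f : A ⇒ B} → f ≈ f
      refl′ = Equiv.refl
      sym′ : ∀ {A B} {f g : A ⇒ B} → f ≈ g → g ≈ f
      sym′ = Equiv.sym
      _⟫_ : ∀ {A B} {f g h : A ⇒ B} → f ≈ g → g ≈ h → f ≈ h
      _⟫_ = Equiv.trans
      infixr 5 _⟫_
      ra : ∀ {A B C D} {f : A ⇒ B} {g : B ⇒ C} {h : C ⇒ D} → (h ∘ g) ∘ f ≈ h ∘ (g ∘ f)
      ra = Category.assoc C
      la : ∀ {A B C D} {f : A ⇒ B} {g : B ⇒ C} {h : C ⇒ D} → h ∘ (g ∘ f) ≈ (h ∘ g) ∘ f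
      la = sym′ (Category.assoc C)
      kassoc : ∀ {A B C D} {f : A ⇒ T₀ B} {g : B ⇒ T₀ C} {h : C ⇒ T₀ D} →
               μ D ∘ T₁ (μ D ∘ T₁ h ∘ g) ∘ f ≈ μ D ∘ T₁ h ∘ (μ C ∘ T₁ g ∘ f)
      kassoc {A} {B} {C′} {D} {f} {g} {h} =
        -- LHS: μ ∘ (T μ ∘ T T h ∘ T g) ∘ f
        ∘-resp-≈ refl′ (∘-resp-≈ (homomorphism ⟫ ∘-resp-≈ refl′ homomorphism) refl′)
        -- μ ∘ ((Tμ ∘ (TTh ∘ Tg)) ∘ f)
        ⟫ ∘-resp-≈ refl′ ra
        ⟫ la
        -- (μ ∘ Tμ) ∘ ((TTh ∘ Tg) ∘ f)
        ⟫ ∘-resp-≈ (Monad.assoc M) refl′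
        ⟫ ra
        -- μ ∘ (μ ∘ ((TTh ∘ Tg) ∘ f))
        ⟫ ∘-resp-≈ refl′ (∘-resp-≈ refl′ ra ⟫ la ⟫ ∘-resp-≈ (μ-natural h) refl′ ⟫ ra)
        -- μ ∘ (Th ∘ (μ ∘ (Tg ∘ f)))
      kidl : ∀ {A B} {f : A ⇒ T₀ B} → μ B ∘ T₁ (η B) ∘ f ≈ f
      kidl = la ⟫ ∘-resp-≈ (Monad.identityˡ M) refl′ ⟫ Category.identityˡ C
      kidr : ∀ {A B} {f : A ⇒ T₀ B} → μ B ∘ T₁ f ∘ η A ≈ f
      kidr {A} {B} {f} = ∘-resp-≈ refl′ (sym′ (η-natural f)) ⟫ la
                       ⟫ ∘-resp-≈ (Monad.identityʳ M) refl′ ⟫ Category.identityˡ C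

  -- Object/morphism parts of the canonical functors (functor laws are not
  -- needed for the statement, which only concerns the action on morphisms).
  -- C_T → C :  A ↦ T(A),  f ↦ μ ∘ T(f)
  Kleisli⇒C₀ : Obj → Obj
  Kleisli⇒C₀ = T₀
  Kleisli⇒C₁ : ∀ {A B} → A ⇒ T₀ B → T₀ A ⇒ T₀ B
  Kleisli⇒C₁ {A} {B} f = μ B ∘ T₁ f
  C⇒Kleisli₁ : ∀ {A B} → A ⇒ B → A ⇒ T₀ B
  C⇒Kleisli₁ {A} {B} f = η B ∘ f

module _ {o ℓ e} (𝒞 : DaggerCategory o ℓ e) (M : Monad (DaggerCategory.category 𝒞)) where
  open DaggerCategory 𝒞
  open Monad M

  kleisli-† : ∀ {A B} → A ⇒ T₀ B → B ⇒ T₀ A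
  kleisli-† {A} {B} f = T₁ (f †) ∘ (μ B) † ∘ η B

-- Extending along the monad, f ↦ f♯ = μ ∘ T f, is faithful (f ≈ f♯ ∘ η) and
-- sends Kleisli composition to composition. Hence every dagger law for the
-- Kleisli dagger f‡ follows from the corresponding law in 𝒞 once we know
-- (f‡)♯ ≈ (f♯)†, which is also the compatibility with C_T → C. That identity
-- rests on μ† being natural (the dagger of naturality of μ) and on the
-- Frobenius law, which together give (μ† ∘ η)♯ ≈ μ†.
module Submission where

open import Defs
open import Data.Product using (_×_; _,_)
open import Relation.Binary.Bundles using (Setoid)
import Relation.Binary.Reasoning.Setoid as SetoidReasoning

module CategoryReasoning {o ℓ e} (C : Category o ℓ e) where
  open Category C

  hom-setoid : ∀ {A B} → Setoid ℓ e
  hom-setoid {A} {B} = record { Carrier = A ⇒ B ; _≈_ = _≈_ ; isEquivalence = equiv }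

  module HomReasoning {A B : Obj} where
    open SetoidReasoning (hom-setoid {A} {B}) public
    open Setoid (hom-setoid {A} {B}) public using (refl; sym; trans)

  open HomReasoning public

  infixr 4 _⟩∘⟨_ refl⟩∘⟨_
  infixl 5 _⟩∘⟨refl

  _⟩∘⟨_ : ∀ {A B C} {f h : B ⇒ C} {g i : A ⇒ B} → f ≈ h → g ≈ i → f ∘ g ≈ h ∘ i
  _⟩∘⟨_ = ∘-resp-≈

  refl⟩∘⟨_ : ∀ {A B C} {f : B ⇒ C} {g i : A ⇒ B} → g ≈ i → f ∘ g ≈ f ∘ i
  refl⟩∘⟨ p = refl ⟩∘⟨ p

  _⟩∘⟨refl : ∀ {A B C} {f h : B ⇒ C} {g : A ⇒ B} → f ≈ h → f ∘ g ≈ h ∘ g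
  p ⟩∘⟨refl = p ⟩∘⟨ refl

  assocˡ : ∀ {A B C D} {f : A ⇒ B} {g : B ⇒ C} {h : C ⇒ D} → h ∘ (g ∘ f) ≈ (h ∘ g) ∘ f
  assocˡ = sym assoc

module KleisliExtension {o ℓ e} {C : Category o ℓ e} (M : Monad C) where
  open Category C hiding (assoc; identityˡ; identityʳ)
  open CategoryReasoning C
  open Monad M
  private module Kl = Category (Kleisli M)

  infix 10 _♯
  _♯ : ∀ {A B} → A ⇒ T₀ B → T₀ A ⇒ T₀ B
  _♯ = Kleisli⇒C₁ M

  ♯-∘η : ∀ {A B} (f : A ⇒ T₀ B) → f ♯ ∘ η A ≈ f
  ♯-∘η f = trans (Category.assoc C) Kl.identityʳ

  ♯-injective : ∀ {A B} {f g : A ⇒ T₀ B} → f ♯ ≈ g ♯ → f ≈ g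
  ♯-injective {f = f} {g} p = begin
    f           ≈⟨ sym (♯-∘η f) ⟩
    f ♯ ∘ η _   ≈⟨ p ⟩∘⟨refl ⟩
    g ♯ ∘ η _   ≈⟨ ♯-∘η g ⟩
    g           ∎

  η♯ : ∀ {A} → η A ♯ ≈ id
  η♯ = identityˡ

  -- The Kleisli associativity law, precomposed with the Kleisli morphism id : T A → A.
  ♯-homomorphism : ∀ {A B C} {f : A ⇒ T₀ B} {g : B ⇒ T₀ C} →
                   (μ C ∘ T₁ g ∘ f) ♯ ≈ g ♯ ∘ f ♯
  ♯-homomorphism {f = f} {g} = begin
    (μ _ ∘ T₁ g ∘ f) ♯              ≈⟨ sym (Category.identityʳ C) ⟩
    (μ _ ∘ T₁ g ∘ f) ♯ ∘ id         ≈⟨ Category.assoc C ⟩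
    μ _ ∘ T₁ (μ _ ∘ T₁ g ∘ f) ∘ id  ≈⟨ Kl.assoc ⟩
    μ _ ∘ T₁ g ∘ μ _ ∘ T₁ f ∘ id    ≈⟨ refl⟩∘⟨ refl⟩∘⟨ refl⟩∘⟨ Category.identityʳ C ⟩
    μ _ ∘ T₁ g ∘ μ _ ∘ T₁ f         ≈⟨ assocˡ ⟩
    g ♯ ∘ f ♯                       ∎

  ♯-η∘ : ∀ {A B} (f : A ⇒ B) → (η B ∘ f) ♯ ≈ T₁ f
  ♯-η∘ f = begin
    μ _ ∘ T₁ (η _ ∘ f)      ≈⟨ refl⟩∘⟨ homomorphism ⟩
    μ _ ∘ T₁ (η _) ∘ T₁ f   ≈⟨ assocˡ ⟩
    η _ ♯ ∘ T₁ f            ≈⟨ η♯ ⟩∘⟨refl ⟩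
    id ∘ T₁ f               ≈⟨ Category.identityˡ C ⟩
    T₁ f                    ∎

module FrobeniusKleisli {o ℓ e} (𝒞 : DaggerCategory o ℓ e)
                        (M : Monad (DaggerCategory.category 𝒞))
                        (frob : IsFrobenius 𝒞 M) where
  open DaggerCategory 𝒞 hiding (assoc; identityˡ; identityʳ)
  open CategoryReasoning category
  open IsDagger isDagger
  open Monad M
  open IsFrobenius frob
  open KleisliExtension M

  T†-involutive : ∀ {A B} (f : A ⇒ B) → (T₁ (f †)) † ≈ T₁ f
  T†-involutive f = trans (†-resp-≈ (T-† f)) †-involutive

  μ†-natural : ∀ {A B} (f : A ⇒ B) → μ B † ∘ T₁ f ≈ T₁ (T₁ f) ∘ μ A †
  μ†-natural f = begin
    μ _ † ∘ T₁ f                 ≈⟨ refl⟩∘⟨ sym (T†-involutive f) ⟩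
    μ _ † ∘ (T₁ (f †)) †         ≈⟨ sym †-homomorphism ⟩
    (T₁ (f †) ∘ μ _) †           ≈⟨ †-resp-≈ (sym (μ-natural (f †))) ⟩
    (μ _ ∘ T₁ (T₁ (f †))) †      ≈⟨ †-homomorphism ⟩
    (T₁ (T₁ (f †))) † ∘ μ _ †    ≈⟨ trans (†-resp-≈ (F-resp-≈ (T-† f))) (T†-involutive (T₁ f)) ⟩∘⟨refl ⟩
    T₁ (T₁ f) ∘ μ _ †            ∎

  μ†η♯ : ∀ {B} → (μ B † ∘ η B) ♯ ≈ μ B †
  μ†η♯ {B} = begin
    μ (T₀ B) ∘ T₁ (μ B † ∘ η B)              ≈⟨ refl⟩∘⟨ homomorphism ⟩
    μ (T₀ B) ∘ T₁ (μ B †) ∘ T₁ (η B)         ≈⟨ assocˡ ⟩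
    (μ (T₀ B) ∘ T₁ (μ B †)) ∘ T₁ (η B)       ≈⟨ sym (frobenius B) ⟩∘⟨refl ⟩
    (T₁ (μ B) ∘ μ (T₀ B) †) ∘ T₁ (η B)       ≈⟨ Category.assoc category ⟩
    T₁ (μ B) ∘ μ (T₀ B) † ∘ T₁ (η B)         ≈⟨ refl⟩∘⟨ μ†-natural (η B) ⟩
    T₁ (μ B) ∘ T₁ (T₁ (η B)) ∘ μ B †         ≈⟨ assocˡ ⟩
    (T₁ (μ B) ∘ T₁ (T₁ (η B))) ∘ μ B †       ≈⟨ sym homomorphism ⟩∘⟨refl ⟩
    T₁ (η B ♯) ∘ μ B †                       ≈⟨ trans (F-resp-≈ η♯) identity ⟩∘⟨refl ⟩
    id ∘ μ B †                               ≈⟨ Category.identityˡ category ⟩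
    μ B †                                    ∎

  infix 10 _‡
  _‡ : ∀ {A B} → A ⇒ T₀ B → B ⇒ T₀ A
  _‡ = kleisli-† 𝒞 M

  ‡♯ : ∀ {A B} (f : A ⇒ T₀ B) → f ‡ ♯ ≈ (f ♯) †
  ‡♯ f = begin
    μ _ ∘ T₁ (T₁ (f †) ∘ μ _ † ∘ η _)             ≈⟨ refl⟩∘⟨ homomorphism ⟩
    μ _ ∘ T₁ (T₁ (f †)) ∘ T₁ (μ _ † ∘ η _)        ≈⟨ assocˡ ⟩
    (μ _ ∘ T₁ (T₁ (f †))) ∘ T₁ (μ _ † ∘ η _)      ≈⟨ μ-natural (f †) ⟩∘⟨refl ⟩
    (T₁ (f †) ∘ μ _) ∘ T₁ (μ _ † ∘ η _)           ≈⟨ Category.assoc category ⟩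
    T₁ (f †) ∘ (μ _ † ∘ η _) ♯                    ≈⟨ refl⟩∘⟨ μ†η♯ ⟩
    T₁ (f †) ∘ μ _ †                              ≈⟨ T-† f ⟩∘⟨refl ⟩
    (T₁ f) † ∘ μ _ †                              ≈⟨ sym †-homomorphism ⟩
    (f ♯) †                                       ∎

  ‡-identity : ∀ {A} → η A ‡ ≈ η A
  ‡-identity = ♯-injective (begin
    η _ ‡ ♯      ≈⟨ ‡♯ (η _) ⟩
    (η _ ♯) †    ≈⟨ †-resp-≈ η♯ ⟩
    id †         ≈⟨ †-identity ⟩
    id           ≈⟨ sym η♯ ⟩
    η _ ♯        ∎)

  ‡-homomorphism : ∀ {A B C} {f : A ⇒ T₀ B} {g : B ⇒ T₀ C} →
                   (μ C ∘ T₁ g ∘ f) ‡ ≈ μ A ∘ T₁ (f ‡) ∘ g ‡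
  ‡-homomorphism {f = f} {g} = ♯-injective (begin
    (μ _ ∘ T₁ g ∘ f) ‡ ♯       ≈⟨ ‡♯ _ ⟩
    ((μ _ ∘ T₁ g ∘ f) ♯) †     ≈⟨ †-resp-≈ ♯-homomorphism ⟩
    (g ♯ ∘ f ♯) †              ≈⟨ †-homomorphism ⟩
    (f ♯) † ∘ (g ♯) †          ≈⟨ sym (‡♯ f ⟩∘⟨ ‡♯ g) ⟩
    f ‡ ♯ ∘ g ‡ ♯              ≈⟨ sym ♯-homomorphism ⟩
    (μ _ ∘ T₁ (f ‡) ∘ g ‡) ♯   ∎)

  ‡-involutive : ∀ {A B} {f : A ⇒ T₀ B} → f ‡ ‡ ≈ f
  ‡-involutive {f = f} = ♯-injective (begin
    f ‡ ‡ ♯       ≈⟨ ‡♯ (f ‡) ⟩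
    (f ‡ ♯) †     ≈⟨ †-resp-≈ (‡♯ f) ⟩
    (f ♯) † †     ≈⟨ †-involutive ⟩
    f ♯           ∎)

  ‡-isDagger : IsDagger (Kleisli M) _‡
  ‡-isDagger = record
    { †-resp-≈       = λ p → F-resp-≈ (†-resp-≈ p) ⟩∘⟨refl
    ; †-identity     = ‡-identity
    ; †-homomorphism = ‡-homomorphism
    ; †-involutive   = ‡-involutive
    }

  η∘†≈‡ : ∀ {A B} (f : A ⇒ B) → η A ∘ f † ≈ (η B ∘ f) ‡
  η∘†≈‡ f = ♯-injective (begin
    (η _ ∘ f †) ♯      ≈⟨ ♯-η∘ (f †) ⟩
    T₁ (f †)           ≈⟨ T-† f ⟩
    (T₁ f) †           ≈⟨ †-resp-≈ (sym (♯-η∘ f)) ⟩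
    ((η _ ∘ f) ♯) †    ≈⟨ sym (‡♯ (η _ ∘ f)) ⟩
    (η _ ∘ f) ‡ ♯      ∎)

lemma5p2 : ∀ {o ℓ e} (𝒞 : DaggerCategory o ℓ e)
             (M : Monad (DaggerCategory.category 𝒞)) →
             IsFrobenius 𝒞 M →
             IsDagger (Kleisli M) (kleisli-† 𝒞 M)
             × (∀ {A B} (f : DaggerCategory._⇒_ 𝒞 A (Monad.T₀ M B)) →
                  DaggerCategory._≈_ 𝒞 (Kleisli⇒C₁ M (kleisli-† 𝒞 M f))
                                       (DaggerCategory._† 𝒞 (Kleisli⇒C₁ M f)))
             × (∀ {A B} (f : DaggerCategory._⇒_ 𝒞 A B) →
                  DaggerCategory._≈_ 𝒞 (C⇒Kleisli₁ M (DaggerCategory._† 𝒞 f))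
                                       (kleisli-† 𝒞 M (C⇒Kleisli₁ M f)))
lemma5p2 𝒞 M frob = ‡-isDagger , ‡♯ , η∘†≈‡
  where open FrobeniusKleisli 𝒞 M frob
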